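{- Let $(m,n)$ be a coprime pair of positive integers, let $\Sigma$ be the $(S,W)$-word of some $D\in\mathcal D_{m,n}$, and let $R^{(0)}$ be a weakly increasing sequence of $m+n$ nonnegative integers. Run the WeakFindRank algorithm starting from $T(\Sigma,R^{(0)})$. If at some step the row count $c(k)$ of the current path diagram is $\ge 0$, then $c(k)\ge 0$ in all subsequent path diagrams produced by the algorithm. In particular, with $U=\max(R^{(0)})+m+1$, one has $c(k)\ge 0$ for all $k>U$ in all path diagrams produced by the algorithm.
   Context: $(m,n)$-Dyck paths: lattice paths from $(0,0)$ to $(m,n)$ with $n$ North and $m$ East unit steps staying weakly above $y=nx/m$; $\mathcal D_{m,n}$ is their set. The $(S,W)$-word of a path writes $S$ for each North step and $W$ for each East step. Path diagram $T(\Sigma,R)$ for a word $\Sigma=\Sigma_1\cdots\Sigma_{m+n}$ with $n$ letters $S$ and $m$ letters $W$ and an integer sequence $R=(r_1,\dots,r_{m+n})$: arrows $A_1,\dots,A_{m+n}$, where $A_i$ goes from $(i-1,r_i)$ to $(i,r_i+m)$ (red) if $\Sigma_i=S$ and from $(i-1,r_i)$ to $(i,r_i-n)$ (blue) if $\Sigma_i=W$; $r_i$ is the starting rank of $A_i$. Row $j$ ($j\in\mathbb Z$) is the strip between $y=j$ and $y=j+1$; a red arrow with starting rank $r$ has a segment in rows $r,\dots,r+m-1$, a blue one in rows $r-n,\dots,r-1$. The row count is $c(j)=c^r(j)-c^b(j)$, the number of red minus the number of blue arrows having a segment in row $j$. $T(\Sigma,R)$ is balanced if all row counts vanish. WeakFindRank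 algorithm: start with $R=R^{(0)}$. Repeat: if all row counts of $T(\Sigma,R)$ are $\le 0$, stop and output $R$. Otherwise let $j$ be the lowest row with $c(j)>0$, let $i$ be the largest index with $r_i=j$ (the rightmost arrow starting at level $j$), and replace $r_i$ by $r_i+1$, keeping the other entries. -}

module Defs where

open import Data.Nat as ℕ using (ℕ; zero; suc)
open import Data.Integer as ℤ using (ℤ; +_; _+_; _-_; _≤_; _<_; _≤?_; _<?_; _⊔_)
open import Data.Fin as Fin using (Fin)
open import Data.Fin.Base using () renaming (_<_ to _<ᶠ_)
open import Data.List using (List; []; _∷_; map; length; take; foldr; allFin)
open import Data.List.Base using (lookup)
open import Data.Bool using (Bool; true; false; if_then_else_; _∧_)
open import Data.Product using (Σ-syntax; _×_)
open import Relation.Nullary.Decidable using (⌊_⌋)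
open import Relation.Binary.PropositionalEquality using (_≡_; _≢_)

data Dir : Set where
  North East : Dir

data Letter : Set where
  S W : Letter

xcoord : List Dir → ℕ
xcoord [] = 0
xcoord (East ∷ d) = suc (xcoord d)
xcoord (North ∷ d) = xcoord d

ycoord : List Dir → ℕ
ycoord [] = 0
ycoord (North ∷ d) = suc (ycoord d)
ycoord (East ∷ d) = ycoord d

-- D ∈ 𝒟_{m,n}: path from (0,0) to (m,n) whose lattice points (x,y)
-- all satisfy y ≥ n x / m, i.e. n * x ≤ m * y.
IsDyck : ℕ → ℕ → List Dir → Set
IsDyck m n D =
  xcoord D ≡ m × ycoord D ≡ n ×
  (∀ k → n ℕ.* xcoord (take k D) ℕ.≤ m ℕ.* ycoord (take k D))

letterOf : Dir → Letter
letterOf North = S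
letterOf East = W

swWord : List Dir → List Letter
swWord = map letterOf

Ranks : List Letter → Set
Ranks w = Fin (length w) → ℤ

-- contribution of an arrow with letter x and starting rank r to row j:
-- red (S): +1 in rows r..r+m-1; blue (W): -1 in rows r-n..r-1.
contrib : ℕ → ℕ → Letter → ℤ → ℤ → ℤ
contrib m n S r j = if ⌊ r ≤? j ⌋ ∧ ⌊ j <? r + + m ⌋ then + 1 else + 0
contrib m n W r j = if ⌊ r - + n ≤? j ⌋ ∧ ⌊ j <? r ⌋ then ℤ.- + 1 else + 0

sumℤ : List ℤ → ℤ
sumℤ = foldr _+_ (+ 0)

rowCount : ℕ → ℕ → (w : List Letter) → Ranks w → ℤ → ℤ
rowCount m n w R j = sumℤ (map (λ i → contrib m n (lookup w i) (R i) j) (allFin (length w)))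

WFRStep : ℕ → ℕ → (w : List Letter) → Ranks w → Ranks w → Set
WFRStep m n w R R' =
  Σ[ j ∈ ℤ ] (+ 0 < rowCount m n w R j) ×
    (∀ j' → j' < j → rowCount m n w R j' ≤ + 0) ×
    (Σ[ i ∈ Fin (length w) ] R i ≡ j ×
      (∀ i' → i <ᶠ i' → R i' ≢ j) ×
      R' i ≡ R i + + 1 ×
      (∀ i' → i' ≢ i → R' i' ≡ R i'))

-- max(R) for a nonnegative sequence
maxRank : (w : List Letter) → Ranks w → ℤ
maxRank w R = foldr _⊔_ (+ 0) (map R (allFin (length w)))

-- Raising the starting rank of one arrow by one moves exactly one of its row
-- segments: a red arrow starting at j leaves row j and enters row j + m, a
-- blue one leaves row j - n (raising its count) and enters row j.  So a
-- WeakFindRank step can lower a row count only in the row j it works on, and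
-- there only by one, while c(j) > 0 beforehand; nonnegative rows stay
-- nonnegative.  Above max(R₀) no blue arrow of T(Σ,R₀) has a segment, so
-- those rows start out nonnegative.
module Submission where

open import Defs
open import Data.Nat using (ℕ; z≤n)
open import Data.Nat.Coprimality using (Coprime)
open import Data.Integer using (ℤ; +_; _+_; _-_; _≤_; _<_; _≤?_; _<?_; _≟_; _⊔_; -_; -≤+; +≤+)
open import Data.Integer.Properties
open import Data.Fin using (Fin; zero; suc)
open import Data.Fin.Properties using (suc-injective)
open import Data.List using (List; length; tabulate; foldr)
open import Data.List.Base using (lookup)
open import Data.List.Properties using (map-tabulate)
open import Data.Bool using (true; false; if_then_else_; _∧_)
open import Data.Product using (_×_; _,_; proj₁; proj₂)
open import Function using (_∘_)
open import Data.Empty using (⊥-elim)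
open import Relation.Nullary using (yes; no)
open import Relation.Nullary.Decidable using (⌊_⌋)
open import Relation.Binary.PropositionalEquality
open import Relation.Binary.Construct.Closure.ReflexiveTransitive using (Star; ε; _◅_)

i≤i+1 : ∀ i → i ≤ i + + 1
i≤i+1 i = i≤i+j i (+ 1)

i<j+1⇒i≤j : ∀ {i j} → i < j + + 1 → i ≤ j
i<j+1⇒i≤j {i} {j} i<j+1 = subst₂ _≤_ (pred-suc i) (pred-suc j)
  (pred-mono (subst (Data.Integer.suc i ≤_) (+-comm j (+ 1)) (i<j⇒suc[i]≤j i<j+1)))

i≤j∧j≢i⇒i+1≤j : ∀ {i j} → i ≤ j → j ≢ i → i + + 1 ≤ j
i≤j∧j≢i⇒i+1≤j {i} {j} i≤j j≢i = subst (_≤ j) (+-comm (+ 1) i)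
  (i<j⇒suc[i]≤j (≤∧≢⇒< i≤j (λ i≡j → j≢i (sym i≡j))))

0≤red : ∀ b → + 0 ≤ (if b then + 1 else + 0)
0≤red true  = +≤+ z≤n
0≤red false = +≤+ z≤n

red≤1 : ∀ b → (if b then + 1 else + 0) ≤ + 1
red≤1 true  = ≤-refl
red≤1 false = +≤+ z≤n

blue≤0 : ∀ b → (if b then - + 1 else + 0) ≤ + 0
blue≤0 true  = -≤+
blue≤0 false = ≤-refl

-1≤blue : ∀ b → - + 1 ≤ (if b then - + 1 else + 0)
-1≤blue true  = ≤-refl
-1≤blue false = -≤+

module _ (m n : ℕ) where

  contrib-raise-mono : ∀ x r k → k ≢ r → contrib m n x r k ≤ contrib m n x (r + + 1) k
  contrib-raise-mono S r k k≢r
    with r ≤? k | k <? r + + m | r + + 1 ≤? k | k <? r + + 1 + + m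
  ... | yes _   | yes _   | yes _ | yes _ = ≤-refl
  ... | yes r≤k | yes _   | no  ¬ | _     = ⊥-elim (¬ (i≤j∧j≢i⇒i+1≤j r≤k k≢r))
  ... | yes _   | yes k<u | yes _ | no  ¬ = ⊥-elim (¬ (<-≤-trans k<u (+-monoˡ-≤ (+ m) (i≤i+1 r))))
  ... | yes _   | no  _   | c     | d     = 0≤red (⌊ c ⌋ ∧ ⌊ d ⌋)
  ... | no  _   | _       | c     | d     = 0≤red (⌊ c ⌋ ∧ ⌊ d ⌋)
  contrib-raise-mono W r k k≢r
    with r + + 1 - + n ≤? k | k <? r + + 1 | r - + n ≤? k | k <? r
  ... | yes _   | yes _     | yes _ | yes _ = ≤-refl
  ... | yes l≤k | yes _     | no  ¬ | _     = ⊥-elim (¬ (≤-trans (+-monoˡ-≤ (- + n) (i≤i+1 r)) l≤k))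
  ... | yes _   | yes k<r+1 | yes _ | no  ¬ = ⊥-elim (¬ (≤∧≢⇒< (i<j+1⇒i≤j k<r+1) k≢r))
  ... | yes _   | no  _     | a     | b     = ≤-trans (blue≤0 (⌊ a ⌋ ∧ ⌊ b ⌋)) (+≤+ z≤n)
  ... | no  _   | _         | a     | b     = ≤-trans (blue≤0 (⌊ a ⌋ ∧ ⌊ b ⌋)) (+≤+ z≤n)

  contrib-raise-drop≤1 : ∀ x r k → contrib m n x r k ≤ contrib m n x (r + + 1) k + + 1
  contrib-raise-drop≤1 S r k = ≤-trans (red≤1 (⌊ r ≤? k ⌋ ∧ ⌊ k <? r + + m ⌋))
    (+-monoˡ-≤ (+ 1) (0≤red (⌊ r + + 1 ≤? k ⌋ ∧ ⌊ k <? r + + 1 + + m ⌋)))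
  contrib-raise-drop≤1 W r k = ≤-trans (blue≤0 (⌊ r - + n ≤? k ⌋ ∧ ⌊ k <? r ⌋))
    (+-monoˡ-≤ (+ 1) (-1≤blue (⌊ r + + 1 - + n ≤? k ⌋ ∧ ⌊ k <? r + + 1 ⌋)))

  0≤contrib-above : ∀ x r k → r ≤ k → + 0 ≤ contrib m n x r k
  0≤contrib-above S r k _ = 0≤red _
  0≤contrib-above W r k r≤k with r - + n ≤? k | k <? r
  ... | yes _ | yes k<r = ⊥-elim (<⇒≱ k<r r≤k)
  ... | yes _ | no  _   = ≤-refl
  ... | no  _ | _       = ≤-refl

sum-mono : ∀ {N} (f g : Fin N → ℤ) → (∀ i → f i ≤ g i) →
  sumℤ (tabulate f) ≤ sumℤ (tabulate g)
sum-mono {ℕ.zero}  f g f≤g = ≤-refl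
sum-mono {ℕ.suc N} f g f≤g =
  +-mono-≤ (f≤g zero) (sum-mono (f ∘ suc) (g ∘ suc) (f≤g ∘ suc))

0≤sum : ∀ {N} (f : Fin N → ℤ) → (∀ i → + 0 ≤ f i) → + 0 ≤ sumℤ (tabulate f)
0≤sum {ℕ.zero}  f 0≤f = ≤-refl
0≤sum {ℕ.suc N} f 0≤f = +-mono-≤ (0≤f zero) (0≤sum (f ∘ suc) (0≤f ∘ suc))

sum-mono-except-one : ∀ {N} (f g : Fin N → ℤ) (i₀ : Fin N) →
  (∀ i → i ≢ i₀ → f i ≤ g i) → f i₀ ≤ g i₀ + + 1 →
  sumℤ (tabulate f) ≤ sumℤ (tabulate g) + + 1
sum-mono-except-one {ℕ.suc N} f g zero f≤g f₀≤g₀+1 =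
  subst (_ ≤_) (+-comm-middle (g zero) (sumℤ (tabulate (g ∘ suc))))
    (+-mono-≤ f₀≤g₀+1 (sum-mono (f ∘ suc) (g ∘ suc) (λ i → f≤g (suc i) (λ ()))))
  where
  +-comm-middle : ∀ a b → a + + 1 + b ≡ a + b + + 1
  +-comm-middle a b = begin
    a + + 1 + b    ≡⟨ +-assoc a (+ 1) b ⟩
    a + (+ 1 + b)  ≡⟨ cong (λ c → a + c) (+-comm (+ 1) b) ⟩
    a + (b + + 1)  ≡⟨ +-assoc a b (+ 1) ⟨
    a + b + + 1    ∎
    where open ≡-Reasoning
sum-mono-except-one {ℕ.suc N} f g (suc i₀) f≤g f₀≤g₀+1 =
  subst (_ ≤_) (sym (+-assoc (g zero) _ (+ 1)))
    (+-mono-≤ (f≤g zero (λ ()))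
      (sum-mono-except-one (f ∘ suc) (g ∘ suc) i₀
        (λ i i≢i₀ → f≤g (suc i) (λ e → i≢i₀ (suc-injective e))) f₀≤g₀+1))

≤-maxRank : ∀ w (R : Ranks w) i → R i ≤ maxRank w R
≤-maxRank w R i = subst (R i ≤_) (cong (foldr _⊔_ (+ 0)) (sym (map-tabulate (λ j → j) R)))
  (≤-foldr-⊔ R i)
  where
  ≤-foldr-⊔ : ∀ {N} (f : Fin N → ℤ) i → f i ≤ foldr _⊔_ (+ 0) (tabulate f)
  ≤-foldr-⊔ f zero    = i≤i⊔j (f zero) _
  ≤-foldr-⊔ f (suc i) = ≤-trans (≤-foldr-⊔ (f ∘ suc) i) (i≤j⊔i (f zero) _)

module _ (m n : ℕ) (w : List Letter) where

  rowTerm : Ranks w → ℤ → Fin (length w) → ℤ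
  rowTerm R k i = contrib m n (lookup w i) (R i) k

  rowCount≡sum : ∀ R k → rowCount m n w R k ≡ sumℤ (tabulate (rowTerm R k))
  rowCount≡sum R k = cong sumℤ (map-tabulate (λ i → i) (rowTerm R k))

  RaisedAt : Fin (length w) → Ranks w → Ranks w → Set
  RaisedAt i₀ R R' = R' i₀ ≡ R i₀ + + 1 × (∀ i → i ≢ i₀ → R' i ≡ R i)

  module _ {i₀ R R'} (raised : RaisedAt i₀ R R') (k : ℤ) where

    rowTerm-unchanged : ∀ i → i ≢ i₀ → rowTerm R k i ≤ rowTerm R' k i
    rowTerm-unchanged i i≢i₀ =
      ≤-reflexive (cong (λ r → contrib m n (lookup w i) r k) (sym (proj₂ raised i i≢i₀)))

    rowTerm-raised : rowTerm R' k i₀ ≡ contrib m n (lookup w i₀) (R i₀ + + 1) k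
    rowTerm-raised = cong (λ r → contrib m n (lookup w i₀) r k) (proj₁ raised)

    rowCount-raise-mono : k ≢ R i₀ → rowCount m n w R k ≤ rowCount m n w R' k
    rowCount-raise-mono k≢r = subst₂ _≤_ (sym (rowCount≡sum R k)) (sym (rowCount≡sum R' k))
      (sum-mono (rowTerm R k) (rowTerm R' k) termwise)
      where
      termwise : ∀ i → rowTerm R k i ≤ rowTerm R' k i
      termwise i with i Data.Fin.≟ i₀
      ... | yes refl = subst (rowTerm R k i ≤_) (sym rowTerm-raised)
                         (contrib-raise-mono m n (lookup w i) (R i) k k≢r)
      ... | no i≢i₀  = rowTerm-unchanged i i≢i₀

    rowCount-raise-drop≤1 : rowCount m n w R k ≤ rowCount m n w R' k + + 1
    rowCount-raise-drop≤1 =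
      subst₂ _≤_ (sym (rowCount≡sum R k)) (cong (λ c → c + + 1) (sym (rowCount≡sum R' k)))
      (sum-mono-except-one (rowTerm R k) (rowTerm R' k) i₀ rowTerm-unchanged
        (subst (λ c → rowTerm R k i₀ ≤ c + + 1) (sym rowTerm-raised)
          (contrib-raise-drop≤1 m n (lookup w i₀) (R i₀) k)))

  WFRStep-preserves-0≤rowCount : ∀ {R R'} k → WFRStep m n w R R' →
    + 0 ≤ rowCount m n w R k → + 0 ≤ rowCount m n w R' k
  WFRStep-preserves-0≤rowCount k (j , 0<c[j] , _ , i₀ , R[i₀]≡j , _ , raised) 0≤c[k]
    with k ≟ j
  ... | yes refl = i<j+1⇒i≤j (<-≤-trans 0<c[j] (rowCount-raise-drop≤1 raised k))
  ... | no  k≢j  = ≤-trans 0≤c[k] (rowCount-raise-mono raised k (λ k≡r → k≢j (trans k≡r R[i₀]≡j)))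

  Star-preserves-0≤rowCount : ∀ {R R'} k → Star (WFRStep m n w) R R' →
    + 0 ≤ rowCount m n w R k → + 0 ≤ rowCount m n w R' k
  Star-preserves-0≤rowCount k ε        0≤c = 0≤c
  Star-preserves-0≤rowCount k (s ◅ ss) 0≤c =
    Star-preserves-0≤rowCount k ss (WFRStep-preserves-0≤rowCount k s 0≤c)

  0≤rowCount-above-maxRank : ∀ R k → maxRank w R < k → + 0 ≤ rowCount m n w R k
  0≤rowCount-above-maxRank R k max<k = subst (+ 0 ≤_) (sym (rowCount≡sum R k))
    (0≤sum (rowTerm R k) (λ i →
      0≤contrib-above m n (lookup w i) (R i) k (<⇒≤ (≤-<-trans (≤-maxRank w R i) max<k))))

lemma3 : (m n : ℕ) → 0 Data.Nat.< m → 0 Data.Nat.< n → Coprime m n →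
    (D : List Dir) → IsDyck m n D →
    (R₀ : Ranks (swWord D)) →
    (∀ i → + 0 ≤ R₀ i) →
    (∀ i i' → i Data.Fin.≤ i' → R₀ i ≤ R₀ i') →
    ((R R' : Ranks (swWord D)) (k : ℤ) →
      Star (WFRStep m n (swWord D)) R₀ R →
      Star (WFRStep m n (swWord D)) R R' →
      + 0 ≤ rowCount m n (swWord D) R k →
      + 0 ≤ rowCount m n (swWord D) R' k)
    ×
    ((R : Ranks (swWord D)) (k : ℤ) →
      Star (WFRStep m n (swWord D)) R₀ R →
      maxRank (swWord D) R₀ + + m + + 1 < k →
      + 0 ≤ rowCount m n (swWord D) R k)
lemma3 m n _ _ _ D _ R₀ _ _ =
  (λ R R' k _ → Star-preserves-0≤rowCount m n w k) ,
  (λ R k steps U<k → Star-preserves-0≤rowCount m n w k steps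
    (0≤rowCount-above-maxRank m n w R₀ k (≤-<-trans max≤U U<k)))
  where
  w = swWord D
  max≤U : maxRank w R₀ ≤ maxRank w R₀ + + m + + 1
  max≤U = ≤-trans (i≤i+j (maxRank w R₀) (+ m)) (i≤i+1 _)
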